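{- Let $\mathbf{x}=f^\omega(0)$. For every $n\ge 1$, $\mathbf{x}$ has exactly two right-special factors $u$ and $v$ of length $n$, where $u$ ends with $0$ and $u1,u2$ are factors of $\mathbf{x}$, and $v$ ends with $2$ and $v0,v2$ are factors of $\mathbf{x}$.
   Context: $f(0)=01$, $f(1)=022$, $f(2)=02$ on $\Sigma_3=\{0,1,2\}$; $f^\omega(0)$ is its fixed point beginning with $0$. A factor $w$ of an infinite word $\mathbf{u}$ is right-special if there are at least two distinct letters $a$ such that $wa$ is a factor of $\mathbf{u}$. -}

module Defs where

open import Data.Nat using (ℕ; zero; suc; _+_)
open import Data.Fin using (Fin; zero; suc)
open import Data.List using (List; []; _∷_; _++_; concatMap; length; _∷ʳ_)
open import Data.Product using (Σ; ∃; _×_; _,_)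
open import Relation.Binary.PropositionalEquality using (_≡_)
open import Relation.Nullary using (¬_)

Letter : Set
Letter = Fin 3

f : Letter → List Letter
f zero             = zero ∷ suc zero ∷ []
f (suc zero)       = zero ∷ suc (suc zero) ∷ suc (suc zero) ∷ []
f (suc (suc zero)) = zero ∷ suc (suc zero) ∷ []

fWord : List Letter → List Letter
fWord = concatMap f

fIter : ℕ → List Letter
fIter zero    = zero ∷ []
fIter (suc k) = fWord (fIter k)

-- i-th letter of a word, with default 0 if out of range
nth : List Letter → ℕ → Letter
nth []       _       = zero
nth (a ∷ w)  zero    = a
nth (a ∷ w)  (suc i) = nth w i

-- Each f^k(0) is a prefix of f^(k+1)(0) (since f(0) starts with 0) and
-- |f^k(0)| ≥ k+1, so the i-th letter of f^ω(0) is the i-th letter of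
-- f^(i+1)(0) (which is in range; the default is never used).
x : ℕ → Letter
x i = nth (fIter (suc i)) i

window : (ℕ → Letter) → ℕ → ℕ → List Letter
window u i zero    = []
window u i (suc n) = u i ∷ window u (suc i) n

Factor : (ℕ → Letter) → List Letter → Set
Factor u w = ∃ λ i → window u i (length w) ≡ w

RightSpecial : (ℕ → Letter) → List Letter → Set
RightSpecial u w = Σ Letter λ a → Σ Letter λ b →
  ¬ (a ≡ b) × Factor u (w ∷ʳ a) × Factor u (w ∷ʳ b)

-- Every factor of x is admissible: its factors of length two lie among 01, 02, 10, 20, 22,
-- and 222 does not occur. So a nonempty right-special factor w cannot be followed by both 0
-- and 1; either w·1, w·2 occur (then w ends in 0) or w·0, w·2 occur (then w ends in 02 or is
-- 2). Such a w has the form r·f(z)·0 or r·f(z)·02 with r a proper suffix of an f-block, and as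
-- the factorisation into f-blocks is unique, two right-special left extensions a·w, b·w
-- desubstitute into left extensions of z that are right-special of the other kind. A mutual
-- induction on length then shows that a right-special word of either kind has at most one
-- right-special left extension of that kind, so there is at most one of each length. Since f
-- maps right-special words of each kind to longer ones of the other, one of each length exists.

module Submission where

open import Defs
open import Data.Bool using (Bool; true; false; _∧_; T)
open import Data.Bool.Properties using (T-∧)
open import Data.Empty using (⊥; ⊥-elim)
open import Data.Fin using (zero; suc)
open import Data.List using (List; []; _∷_; _++_; length; _∷ʳ_; take; drop; initLast; _∷ʳ′_)
open import Data.List.Properties
  using (++-assoc; ++-identityʳ; length-++; ∷-injectiveˡ; ∷-injectiveʳ; ∷ʳ-injective; length-++-≤ʳ;
         length-drop; take++drop≡id)
open import Data.Nat using (ℕ; zero; suc; _+_; _∸_; _≤_; _<_; _≥_; z≤n; s≤s)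
open import Data.Nat.Properties
  using (0≢1+n; suc-injective; ≤-trans; <-trans; <⇒≤; n<1+n; ≤-refl; ≤-reflexive; m≤n⇒m≤1+n;
         +-comm; +-suc; m≤m+n; m∸[m∸n]≡n)
open import Data.Product using (Σ; ∃; _×_; _,_; proj₁; proj₂)
open import Data.Sum using (_⊎_; inj₁; inj₂)
open import Data.Unit using (⊤; tt)
open import Function using (_∘_; Equivalence)
open import Relation.Binary.PropositionalEquality
open ≡-Reasoning
open import Relation.Nullary using (¬_)

pattern L0 = zero
pattern L1 = suc zero
pattern L2 = suc (suc zero)

Word : Set
Word = List Letter

length-∷ʳ : ∀ (w : Word) c → length (w ∷ʳ c) ≡ suc (length w)
length-∷ʳ []      c = refl
length-∷ʳ (a ∷ w) c = cong suc (length-∷ʳ w c)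

∷ʳ-∷ʳ : ∀ (w : Word) a b → w ∷ʳ a ∷ʳ b ≡ w ++ a ∷ b ∷ []
∷ʳ-∷ʳ w a b = ++-assoc w (a ∷ []) (b ∷ [])

∷ʳ-∷ʳ-∷ʳ : ∀ (w : Word) a b c → w ∷ʳ a ∷ʳ b ∷ʳ c ≡ w ++ a ∷ b ∷ c ∷ []
∷ʳ-∷ʳ-∷ʳ w a b c = trans (cong (_∷ʳ c) (∷ʳ-∷ʳ w a b)) (++-assoc w (a ∷ b ∷ []) (c ∷ []))

infix 4 _≼_
_≼_ : Word → Word → Set
w ≼ A = Σ Word λ p → Σ Word λ q → p ++ w ++ q ≡ A

≼-trans : ∀ {u v w} → u ≼ v → v ≼ w → u ≼ w
≼-trans {u} (p , q , refl) (p′ , q′ , refl) = p′ ++ p , q ++ q′ , (begin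
  (p′ ++ p) ++ u ++ q ++ q′   ≡⟨ ++-assoc p′ p _ ⟩
  p′ ++ p ++ u ++ q ++ q′     ≡⟨ cong (λ z → p′ ++ p ++ z) (sym (++-assoc u q q′)) ⟩
  p′ ++ p ++ (u ++ q) ++ q′   ≡⟨ cong (p′ ++_) (sym (++-assoc p (u ++ q) q′)) ⟩
  p′ ++ (p ++ u ++ q) ++ q′   ∎)

fWord-++ : ∀ u v → fWord (u ++ v) ≡ fWord u ++ fWord v
fWord-++ []      v = refl
fWord-++ (a ∷ u) v = trans (cong (f a ++_) (fWord-++ u v)) (sym (++-assoc (f a) (fWord u) (fWord v)))

fWord-≼ : ∀ {w A} → w ≼ A → fWord w ≼ fWord A
fWord-≼ {w} (p , q , refl) =
  fWord p , fWord q , sym (trans (fWord-++ p (w ++ q)) (cong (fWord p ++_) (fWord-++ w q)))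

fTail : Letter → Word
fTail L0 = L1 ∷ []
fTail L1 = L2 ∷ L2 ∷ []
fTail L2 = L2 ∷ []

f≡0∷fTail : ∀ a → f a ≡ L0 ∷ fTail a
f≡0∷fTail L0 = refl
f≡0∷fTail L1 = refl
f≡0∷fTail L2 = refl

fIter-grows : ∀ m → Σ Letter λ e → Σ Word λ E → fIter (suc m) ≡ fIter m ++ e ∷ E
fIter-grows zero    = L1 , [] , refl
fIter-grows (suc m) with e , E , eq ← fIter-grows m = L0 , fTail e ++ fWord E , (begin
  fWord (fIter (suc m))               ≡⟨ cong fWord eq ⟩
  fWord (fIter m ++ e ∷ E)            ≡⟨ fWord-++ (fIter m) (e ∷ E) ⟩
  fIter (suc m) ++ f e ++ fWord E     ≡⟨ cong (λ z → fIter (suc m) ++ z ++ fWord E) (f≡0∷fTail e) ⟩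
  fIter (suc m) ++ L0 ∷ fTail e ++ fWord E ∎)

fIter-prefix : ∀ k m → Σ Word λ B → fIter (k + m) ≡ fIter m ++ B
fIter-prefix zero    m = [] , sym (++-identityʳ _)
fIter-prefix (suc k) m with B , eq ← fIter-prefix k m | e , E , eq′ ← fIter-grows (k + m) =
  B ++ e ∷ E , trans eq′ (trans (cong (_++ e ∷ E) eq) (++-assoc (fIter m) B (e ∷ E)))

length-fIter : ∀ m → m < length (fIter m)
length-fIter zero    = s≤s z≤n
length-fIter (suc m) with e , E , eq ← fIter-grows m rewrite eq | length-++ (fIter m) {e ∷ E} =
  ≤-trans (s≤s (≤-trans (length-fIter m) (m≤m+n _ (length E))))
          (≤-reflexive (sym (+-suc (length (fIter m)) (length E))))

-- Factors of the fixed point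

Occurs : Word → Set
Occurs w = ∃ λ m → w ≼ fIter m

Occurs-≼ : ∀ {w w′} → w ≼ w′ → Occurs w′ → Occurs w
Occurs-≼ i (m , i′) = m , ≼-trans i i′

Occurs-prefix : ∀ w q → Occurs (w ++ q) → Occurs w
Occurs-prefix w q = Occurs-≼ ([] , q , refl)

Occurs-suffix : ∀ p w → Occurs (p ++ w) → Occurs w
Occurs-suffix p w = Occurs-≼ (p , [] , cong (p ++_) (++-identityʳ w))

Occurs-init : ∀ {w a} → Occurs (w ∷ʳ a) → Occurs w
Occurs-init {w} {a} = Occurs-prefix w (a ∷ [])

Occurs-tail : ∀ a w → Occurs (a ∷ w) → Occurs w
Occurs-tail a = Occurs-suffix (a ∷ [])

Occurs-fWord : ∀ {w} → Occurs w → Occurs (fWord w)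
Occurs-fWord (m , i) = suc m , fWord-≼ i

Occurs-f-block : ∀ W e → Occurs (W ∷ʳ e) → Occurs (fWord W ++ f e)
Occurs-f-block W e h =
  subst Occurs (trans (fWord-++ W (e ∷ [])) (cong (fWord W ++_) (++-identityʳ (f e)))) (Occurs-fWord h)

Occurs-in-fWord : ∀ {w} → Occurs w → Σ ℕ λ m → w ≼ fWord (fIter m)
Occurs-in-fWord (m , i) with e , E , eq ← fIter-grows m = m , ≼-trans i ([] , e ∷ E , sym eq)

Occurs-extendʳ : ∀ {w} → Occurs w → Σ Letter λ e → Occurs (w ∷ʳ e)
Occurs-extendʳ {w} (m , p , q , eq) with e , E , eq′ ← fIter-grows m = extend q (begin
  p ++ w ++ q ++ e ∷ E     ≡⟨ cong (p ++_) (sym (++-assoc w q _)) ⟩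
  p ++ (w ++ q) ++ e ∷ E   ≡⟨ sym (++-assoc p (w ++ q) _) ⟩
  (p ++ w ++ q) ++ e ∷ E   ≡⟨ cong (_++ e ∷ E) eq ⟩
  fIter m ++ e ∷ E         ≡⟨ sym eq′ ⟩
  fIter (suc m)            ∎)
  where
  snoc-≼ : ∀ c r → p ++ w ++ c ∷ r ≡ fIter (suc m) → Occurs (w ∷ʳ c)
  snoc-≼ c r eq = suc m , p , r , trans (cong (p ++_) (++-assoc w (c ∷ []) r)) eq
  extend : ∀ q → p ++ w ++ q ++ e ∷ E ≡ fIter (suc m) → Σ Letter λ e′ → Occurs (w ∷ʳ e′)
  extend []      eq = e , snoc-≼ e E eq
  extend (c ∷ q) eq = c , snoc-≼ c (q ++ e ∷ E) eq

HasPrefix : (ℕ → Letter) → Word → Set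
HasPrefix u A = ∀ j → j < length A → u j ≡ nth A j

HasPrefix-tail : ∀ {u a A} → HasPrefix u (a ∷ A) → HasPrefix (u ∘ suc) A
HasPrefix-tail h j lt = h (suc j) (s≤s lt)

nth-++ : ∀ (A B : Word) j → j < length A → nth (A ++ B) j ≡ nth A j
nth-++ (a ∷ A) B zero    _        = refl
nth-++ (a ∷ A) B (suc j) (s≤s lt) = nth-++ A B j lt

-- Both sides are read off the common extension f^(m + j + 1)(0).
x-HasPrefix-fIter : ∀ m → HasPrefix x (fIter m)
x-HasPrefix-fIter m j lt with B₁ , e₁ ← fIter-prefix m (suc j) | B₂ , e₂ ← fIter-prefix (suc j) m = begin
  nth (fIter (suc j)) j        ≡⟨ sym (nth-++ (fIter (suc j)) B₁ j (<-trans (n<1+n j) (length-fIter (suc j)))) ⟩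
  nth (fIter (suc j) ++ B₁) j  ≡⟨ cong (λ z → nth z j) (sym e₁) ⟩
  nth (fIter (m + suc j)) j    ≡⟨ cong (λ k → nth (fIter k) j) (+-comm m (suc j)) ⟩
  nth (fIter (suc j + m)) j    ≡⟨ cong (λ z → nth z j) e₂ ⟩
  nth (fIter m ++ B₂) j        ≡⟨ nth-++ (fIter m) B₂ j lt ⟩
  nth (fIter m) j              ∎

window-suc : ∀ u i n → window u (suc i) n ≡ window (u ∘ suc) i n
window-suc u i zero    = refl
window-suc u i (suc n) = cong (u (suc i) ∷_) (window-suc u (suc i) n)

window-prefix : ∀ u w q → HasPrefix u (w ++ q) → window u 0 (length w) ≡ w
window-prefix u []      q h = refl
window-prefix u (c ∷ w) q h = cong₂ _∷_ (h 0 (s≤s z≤n))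
  (trans (window-suc u 0 (length w)) (window-prefix (u ∘ suc) w q (HasPrefix-tail h)))

window-infix : ∀ u p w q → HasPrefix u (p ++ w ++ q) → window u (length p) (length w) ≡ w
window-infix u []      w q h = window-prefix u w q h
window-infix u (c ∷ p) w q h =
  trans (window-suc u (length p) (length w)) (window-infix (u ∘ suc) p w q (HasPrefix-tail h))

window-extends : ∀ u n A → HasPrefix u A → n ≤ length A → Σ Word λ q → window u 0 n ++ q ≡ A
window-extends u zero    A       h le      = A , refl
window-extends u (suc n) (a ∷ A) h (s≤s le) with q , eq ← window-extends (u ∘ suc) n A (HasPrefix-tail h) le =
  q , cong₂ _∷_ (h 0 (s≤s z≤n)) (trans (cong (_++ q) (window-suc u 0 n)) eq)

window-≼ : ∀ u i n A → HasPrefix u A → i + n ≤ length A → window u i n ≼ A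
window-≼ u zero    n A       h le with q , eq ← window-extends u n A h le = [] , q , eq
window-≼ u (suc i) n (a ∷ A) h (s≤s le) with p , q , eq ← window-≼ (u ∘ suc) i n A (HasPrefix-tail h) le =
  a ∷ p , q , cong (a ∷_) (trans (cong (λ z → p ++ z ++ q) (window-suc u i n)) eq)

Occurs⇒Factor : ∀ {w} → Occurs w → Factor x w
Occurs⇒Factor {w} (m , p , q , eq) =
  length p , window-infix x p w q (subst (HasPrefix x) (sym eq) (x-HasPrefix-fIter m))

Factor⇒Occurs : ∀ {w} → Factor x w → Occurs w
Factor⇒Occurs {w} (i , eq) = m , subst (_≼ fIter m) eq
  (window-≼ x i (length w) (fIter m) (x-HasPrefix-fIter m) (<⇒≤ (length-fIter m)))
  where
  m : ℕ
  m = i + length w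

-- Admissible words

admissible₂ : Letter → Letter → Bool
admissible₂ L0 L1 = true
admissible₂ L0 L2 = true
admissible₂ L1 L0 = true
admissible₂ L2 L0 = true
admissible₂ L2 L2 = true
admissible₂ _  _  = false

not222 : Letter → Letter → Letter → Bool
not222 L2 L2 L2 = false
not222 _  _  _  = true

admissible₃ : Letter → Letter → Letter → Bool
admissible₃ a b c = admissible₂ a b ∧ admissible₂ b c ∧ not222 a b c

admissible : Word → Bool
admissible (a ∷ b ∷ c ∷ w) = admissible₃ a b c ∧ admissible (b ∷ c ∷ w)
admissible (a ∷ b ∷ [])    = admissible₂ a b
admissible _               = true

Admissible : Word → Set
Admissible w = T (admissible w)

split-∧ : ∀ x {y} → T (x ∧ y) → T x × T y
split-∧ x = Equivalence.to (T-∧ {x})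

admissible-tail : ∀ a w → Admissible (a ∷ w) → Admissible w
admissible-tail a []          h = tt
admissible-tail a (b ∷ [])    h = tt
admissible-tail a (b ∷ c ∷ w) h = proj₂ (split-∧ (admissible₃ a b c) h)

admissible-prefix : ∀ w q → Admissible (w ++ q) → Admissible w
admissible-prefix []              q       h = tt
admissible-prefix (a ∷ [])        q       h = tt
admissible-prefix (a ∷ b ∷ [])    []      h = h
admissible-prefix (a ∷ b ∷ [])    (c ∷ q) h =
  proj₁ (split-∧ (admissible₂ a b) (proj₁ (split-∧ (admissible₃ a b c) h)))
admissible-prefix (a ∷ b ∷ c ∷ w) q       h =
  let h₃ , h′ = split-∧ (admissible₃ a b c) h
  in Equivalence.from T-∧ (h₃ , admissible-prefix (b ∷ c ∷ w) q h′)

admissible-suffix : ∀ p w → Admissible (p ++ w) → Admissible w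
admissible-suffix []      w h = h
admissible-suffix (a ∷ p) w h = admissible-suffix p w (admissible-tail a (p ++ w) h)

-- The trailing 0 stands for the first letter of the next f-block.
admissible-f-blocks : ∀ a L → Admissible (f a ++ fWord L ++ L0 ∷ [])
admissible-f-blocks a  []      with a
... | L0 = tt
... | L1 = tt
... | L2 = tt
admissible-f-blocks a (b ∷ L) with a | b
... | L0 | L0 = admissible-f-blocks L0 L
... | L0 | L1 = admissible-f-blocks L1 L
... | L0 | L2 = admissible-f-blocks L2 L
... | L1 | L0 = admissible-f-blocks L0 L
... | L1 | L1 = admissible-f-blocks L1 L
... | L1 | L2 = admissible-f-blocks L2 L
... | L2 | L0 = admissible-f-blocks L0 L
... | L2 | L1 = admissible-f-blocks L1 L
... | L2 | L2 = admissible-f-blocks L2 L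

admissible-fIter : ∀ m → Admissible (fIter m)
admissible-fIter zero    = tt
admissible-fIter (suc m) with fIter m
... | []    = tt
... | a ∷ L = admissible-prefix (fWord (a ∷ L)) _
  (subst Admissible (sym (++-assoc (f a) (fWord L) _)) (admissible-f-blocks a L))

Occurs⇒Admissible : ∀ {w} → Occurs w → Admissible w
Occurs⇒Admissible {w} (m , p , q , eq) =
  admissible-prefix w q (admissible-suffix p (w ++ q) (subst Admissible (sym eq) (admissible-fIter m)))

Occurs⇒Admissible₂ : ∀ {a b w} → Occurs (a ∷ b ∷ w) → Admissible (a ∷ b ∷ [])
Occurs⇒Admissible₂ {a} {b} {w} h = Occurs⇒Admissible (Occurs-prefix (a ∷ b ∷ []) w h)

Occurs⇒Admissible₃ : ∀ {a b c w} → Occurs (a ∷ b ∷ c ∷ w) → Admissible (a ∷ b ∷ c ∷ [])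
Occurs⇒Admissible₃ {a} {b} {c} {w} h = Occurs⇒Admissible (Occurs-prefix (a ∷ b ∷ c ∷ []) w h)

-- Recognizability

ZeroFree : Word → Set
ZeroFree []          = ⊤
ZeroFree (L0 ∷ w)    = ⊥
ZeroFree (suc _ ∷ w) = ZeroFree w

ZeroFree-fTail : ∀ a → ZeroFree (fTail a)
ZeroFree-fTail L0 = tt
ZeroFree-fTail L1 = tt
ZeroFree-fTail L2 = tt

ZeroFree-no-0 : ∀ p w → ¬ ZeroFree (p ++ L0 ∷ w)
ZeroFree-no-0 []          w h = h
ZeroFree-no-0 (L0 ∷ p)    w h = h
ZeroFree-no-0 (suc _ ∷ p) w h = ZeroFree-no-0 p w h

0-beyond-zeroFree-prefix : ∀ t p w M → ZeroFree t → p ++ L0 ∷ w ≡ t ++ M →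
  Σ Word λ p′ → (p ≡ t ++ p′) × (p′ ++ L0 ∷ w ≡ M)
0-beyond-zeroFree-prefix []          p       w M z eq = p , refl , eq
0-beyond-zeroFree-prefix (suc c ∷ t) []      w M z ()
0-beyond-zeroFree-prefix (suc c ∷ t) (d ∷ p) w M z eq with refl ← ∷-injectiveˡ eq
  with p′ , e₁ , e₂ ← 0-beyond-zeroFree-prefix t p w M z (∷-injectiveʳ eq) = p′ , cong (d ∷_) e₁ , e₂

0-before-zeroFree-suffix : ∀ A P s R → ZeroFree s → P ++ s ≡ A ++ L0 ∷ R →
  Σ Word λ P′ → (P ≡ A ++ P′) × (P′ ++ s ≡ L0 ∷ R)
0-before-zeroFree-suffix []      P       s R z eq = P , refl , eq
0-before-zeroFree-suffix (a ∷ A) []      s R z eq = ⊥-elim (ZeroFree-no-0 (a ∷ A) R (subst ZeroFree eq z))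
0-before-zeroFree-suffix (a ∷ A) (b ∷ P) s R z eq with refl ← ∷-injectiveˡ eq
  with P′ , e₁ , e₂ ← 0-before-zeroFree-suffix A P s R z (∷-injectiveʳ eq) = P′ , cong (b ∷_) e₁ , e₂

fWord-cut-at-0 : ∀ L p w → p ++ L0 ∷ w ≡ fWord L →
  Σ Word λ L₁ → Σ Word λ L₂ → (L ≡ L₁ ++ L₂) × (p ≡ fWord L₁) × (L0 ∷ w ≡ fWord L₂)
fWord-cut-at-0 []      []      w ()
fWord-cut-at-0 []      (_ ∷ _) w ()
fWord-cut-at-0 (a ∷ L) []      w eq = [] , a ∷ L , refl , refl , eq
fWord-cut-at-0 (a ∷ L) (c ∷ p) w eq with eq′ ← trans eq (cong (_++ fWord L) (f≡0∷fTail a))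
  with refl ← ∷-injectiveˡ eq′
  with p′ , e₁ , e₂ ← 0-beyond-zeroFree-prefix (fTail a) p w (fWord L) (ZeroFree-fTail a) (∷-injectiveʳ eq′)
  with L₁ , L₂ , q₁ , q₂ , q₃ ← fWord-cut-at-0 L p′ w e₂ =
  a ∷ L₁ , L₂ , cong (a ∷_) q₁ ,
  trans (cong (L0 ∷_) (trans e₁ (cong (fTail a ++_) q₂))) (cong (_++ fWord L₁) (sym (f≡0∷fTail a))) , q₃

fWord-++-0∷≡0∷ : ∀ y w → Σ Word λ R → fWord y ++ L0 ∷ w ≡ L0 ∷ R
fWord-++-0∷≡0∷ []        w = w , refl
fWord-++-0∷≡0∷ (L0 ∷ y)  w = _ , refl
fWord-++-0∷≡0∷ (L1 ∷ y)  w = _ , refl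
fWord-++-0∷≡0∷ (L2 ∷ y)  w = _ , refl

fWord≢2∷ : ∀ L w → ¬ fWord L ≡ L2 ∷ w
fWord≢2∷ (L0 ∷ L) w ()
fWord≢2∷ (L1 ∷ L) w ()
fWord≢2∷ (L2 ∷ L) w ()

-- f is injective on words that are followed by the start of a further f-block.
fWord-++-0∷-injective : ∀ y w L → fWord y ++ L0 ∷ w ≡ fWord L → Σ Word λ L′ → L ≡ y ++ L′
fWord-++-0∷-injective []       w L         eq = L , refl
fWord-++-0∷-injective (L0 ∷ y) w []        ()
fWord-++-0∷-injective (L1 ∷ y) w []        ()
fWord-++-0∷-injective (L2 ∷ y) w []        ()
fWord-++-0∷-injective (L0 ∷ y) w (L0 ∷ L)  eq
  with L′ , e ← fWord-++-0∷-injective y w L (∷-injectiveʳ (∷-injectiveʳ eq)) = L′ , cong (L0 ∷_) e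
fWord-++-0∷-injective (L1 ∷ y) w (L1 ∷ L)  eq
  with L′ , e ← fWord-++-0∷-injective y w L (∷-injectiveʳ (∷-injectiveʳ (∷-injectiveʳ eq))) =
  L′ , cong (L1 ∷_) e
fWord-++-0∷-injective (L2 ∷ y) w (L2 ∷ L)  eq
  with L′ , e ← fWord-++-0∷-injective y w L (∷-injectiveʳ (∷-injectiveʳ eq)) = L′ , cong (L2 ∷_) e
fWord-++-0∷-injective (L0 ∷ y) w (L1 ∷ L)  ()
fWord-++-0∷-injective (L0 ∷ y) w (L2 ∷ L)  ()
fWord-++-0∷-injective (L1 ∷ y) w (L0 ∷ L)  ()
fWord-++-0∷-injective (L2 ∷ y) w (L0 ∷ L)  ()
fWord-++-0∷-injective (L1 ∷ y) w (L2 ∷ L)  eq =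
  ⊥-elim (fWord≢2∷ L _ (sym (∷-injectiveʳ (∷-injectiveʳ eq))))
fWord-++-0∷-injective (L2 ∷ y) w (L1 ∷ L)  eq with R , e ← fWord-++-0∷≡0∷ y w
  with () ← trans (sym e) (∷-injectiveʳ (∷-injectiveʳ eq))

fWord-zeroFree-suffix : ∀ L P s₀ s → ZeroFree (s₀ ∷ s) → P ++ s₀ ∷ s ≡ fWord L →
  Σ Word λ L₀ → Σ Letter λ c → Σ Word λ t → (L ≡ L₀ ∷ʳ c) × (t ++ s₀ ∷ s ≡ f c)
fWord-zeroFree-suffix []            []      s₀ s z ()
fWord-zeroFree-suffix []            (_ ∷ _) s₀ s z ()
fWord-zeroFree-suffix (a ∷ [])      P       s₀ s z eq = [] , a , P , refl , trans eq (++-identityʳ (f a))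
fWord-zeroFree-suffix (a ∷ b ∷ L)   P       s₀ s z eq =
  let P′ , _ , e = 0-before-zeroFree-suffix (f a) P (s₀ ∷ s) _ z
                     (trans eq (cong (λ v → f a ++ v ++ fWord L) (f≡0∷fTail b)))
      L₀ , c , t , q₁ , q₂ = fWord-zeroFree-suffix (b ∷ L) P′ s₀ s z
                               (trans e (cong (_++ fWord L) (sym (f≡0∷fTail b))))
  in a ∷ L₀ , c , t , cong (a ∷_) q₁ , q₂

Occurs-desubstitute : ∀ s y → ZeroFree s → Occurs (s ++ fWord y ++ L0 ∷ []) →
  Σ Word λ L → Σ Word λ P → (P ++ s ≡ fWord L) × Occurs (L ++ y)
Occurs-desubstitute s y z h
  with m , P , Q , eq ← Occurs-in-fWord h
  with R , e ← fWord-++-0∷≡0∷ y Q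
  with L₁ , L₂ , q₁ , q₂ , q₃ ← fWord-cut-at-0 (fIter m) (P ++ s) R (begin
         (P ++ s) ++ L0 ∷ R                   ≡⟨ cong ((P ++ s) ++_) (sym e) ⟩
         (P ++ s) ++ fWord y ++ L0 ∷ Q        ≡⟨ ++-assoc P s _ ⟩
         P ++ s ++ fWord y ++ L0 ∷ Q          ≡⟨ cong (λ v → P ++ s ++ v) (sym (++-assoc (fWord y) _ Q)) ⟩
         P ++ s ++ (fWord y ++ L0 ∷ []) ++ Q  ≡⟨ cong (P ++_) (sym (++-assoc s _ Q)) ⟩
         P ++ (s ++ fWord y ++ L0 ∷ []) ++ Q  ≡⟨ eq ⟩
         fWord (fIter m)                      ∎)
  with L₃ , e′ ← fWord-++-0∷-injective y Q L₂ (trans e q₃) =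
  L₁ , P , q₂ , m , [] , L₃ , sym (trans q₁ (trans (cong (L₁ ++_) e′) (sym (++-assoc L₁ y L₃))))

Occurs-fWord⁻¹ : ∀ y → Occurs (fWord y ++ L0 ∷ []) → Occurs y
Occurs-fWord⁻¹ y h with L , _ , _ , h′ ← Occurs-desubstitute [] y tt h = Occurs-suffix L y h′

Occurs-fWord⁻¹-after : ∀ s₀ s y → ZeroFree (s₀ ∷ s) → Occurs ((s₀ ∷ s) ++ fWord y ++ L0 ∷ []) →
  Σ Letter λ c → Σ Word λ t → (t ++ s₀ ∷ s ≡ f c) × Occurs (c ∷ y)
Occurs-fWord⁻¹-after s₀ s y z h
  with L , P , e , h′ ← Occurs-desubstitute (s₀ ∷ s) y z h
  with L₀ , c , t , refl , e′ ← fWord-zeroFree-suffix L P s₀ s z e =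
  c , t , e′ , Occurs-suffix L₀ (c ∷ y) (subst Occurs (++-assoc L₀ (c ∷ []) y) h′)

¬Admissible-00 : ∀ w → ¬ Admissible (L0 ∷ L0 ∷ w)
¬Admissible-00 []      h = h
¬Admissible-00 (_ ∷ _) h = h

admissible-parse : ∀ w → Admissible (w ++ L0 ∷ []) →
  Σ Word λ r → Σ Word λ z → (w ≡ r ++ fWord z) × ZeroFree r
admissible-parse []      h = [] , [] , refl , tt
admissible-parse (c ∷ w) h with admissible-parse w (admissible-tail c (w ++ L0 ∷ []) h)
admissible-parse (L1 ∷ w) h | r , z , refl , zr = L1 ∷ r , z , refl , zr
admissible-parse (L2 ∷ w) h | r , z , refl , zr = L2 ∷ r , z , refl , zr
admissible-parse (L0 ∷ w) h | [] , z , refl , _ with R , e ← fWord-++-0∷≡0∷ z [] =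
  ⊥-elim (¬Admissible-00 R (subst (λ v → Admissible (L0 ∷ v)) e h))
admissible-parse (L0 ∷ w) h | L1 ∷ []           , z , refl , _ = [] , L0 ∷ z , refl , tt
admissible-parse (L0 ∷ w) h | L1 ∷ L1 ∷ r       , z , refl , _ = ⊥-elim h
admissible-parse (L0 ∷ w) h | L1 ∷ L2 ∷ r       , z , refl , _ = ⊥-elim h
admissible-parse (L0 ∷ w) h | L2 ∷ []           , z , refl , _ = [] , L2 ∷ z , refl , tt
admissible-parse (L0 ∷ w) h | L2 ∷ L1 ∷ r       , z , refl , _ = ⊥-elim h
admissible-parse (L0 ∷ w) h | L2 ∷ L2 ∷ []      , z , refl , _ = [] , L1 ∷ z , refl , tt
admissible-parse (L0 ∷ w) h | L2 ∷ L2 ∷ L1 ∷ r  , z , refl , _ = ⊥-elim h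
admissible-parse (L0 ∷ w) h | L2 ∷ L2 ∷ L2 ∷ r  , z , refl , _ = ⊥-elim h

-- Right-special words

Special : Letter → Letter → Word → Set
Special a b w = Occurs (w ∷ʳ a) × Occurs (w ∷ʳ b)

Special-suffix : ∀ {a b} p w → Special a b (p ++ w) → Special a b w
Special-suffix p w (ha , hb) =
  Occurs-suffix p _ (subst Occurs (++-assoc p w _) ha) , Occurs-suffix p _ (subst Occurs (++-assoc p w _) hb)

0-before-1 : ∀ a → Occurs (a ∷ L1 ∷ []) → a ≡ L0
0-before-1 L0 h = refl
0-before-1 L1 h = ⊥-elim (Occurs⇒Admissible₂ h)
0-before-1 L2 h = ⊥-elim (Occurs⇒Admissible₂ h)

0-after-1 : ∀ e w → Occurs (L1 ∷ e ∷ w) → e ≡ L0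
0-after-1 L0 w h = refl
0-after-1 L1 w h = ⊥-elim (Occurs⇒Admissible₂ h)
0-after-1 L2 w h = ⊥-elim (Occurs⇒Admissible₂ h)

0-after-22 : ∀ e → Occurs (L2 ∷ L2 ∷ e ∷ []) → e ≡ L0
0-after-22 L0 _ = refl
0-after-22 L1 h = ⊥-elim (Occurs⇒Admissible₂ (Occurs-tail L2 _ h))
0-after-22 L2 h = ⊥-elim (Occurs⇒Admissible₃ h)

2-before-0-and-2 : ∀ a → Occurs (a ∷ L0 ∷ []) → Occurs (a ∷ L2 ∷ []) → a ≡ L2
2-before-0-and-2 L0 h _ = ⊥-elim (Occurs⇒Admissible₂ h)
2-before-0-and-2 L1 _ h = ⊥-elim (Occurs⇒Admissible₂ h)
2-before-0-and-2 L2 _ _ = refl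

0-before-22 : ∀ a → Occurs (a ∷ L2 ∷ L2 ∷ []) → a ≡ L0
0-before-22 L0 h = refl
0-before-22 L1 h = ⊥-elim (Occurs⇒Admissible₂ h)
0-before-22 L2 h = ⊥-elim (Occurs⇒Admissible₃ h)

Occurs-last-two : ∀ p c e → Occurs (p ∷ʳ c ∷ʳ e) → Occurs (c ∷ e ∷ [])
Occurs-last-two p c e h = Occurs-suffix p _ (subst Occurs (∷ʳ-∷ʳ p c e) h)

Special01⇒[] : ∀ w → Special L0 L1 w → w ≡ []
Special01⇒[] w (h₀ , h₁) with initLast w
... | []       = refl
... | w′ ∷ʳ′ c with refl ← 0-before-1 c (Occurs-last-two w′ c L1 h₁) =
  ⊥-elim (Occurs⇒Admissible₂ (Occurs-last-two w′ L0 L0 h₀))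

Special02-of-nonzero : ∀ c z d → Occurs (c ∷ z ∷ʳ L0) → Occurs (c ∷ z ∷ʳ d) → ¬ d ≡ L0 →
  Special L0 L2 (c ∷ z)
Special02-of-nonzero c z L0 h₀ h d≢0 = ⊥-elim (d≢0 refl)
Special02-of-nonzero c z L1 h₀ h d≢0 with () ← Special01⇒[] (c ∷ z) (h₀ , h)
Special02-of-nonzero c z L2 h₀ h d≢0 = h₀ , h

-- An occurrence of a·r·f(y)·0 with r zero-free comes from an occurrence of c·y with a·r a
-- suffix of f(c). The table keeps what is used of this: a = 0 when r is 1 or 22, and
-- otherwise the possible letters c; no other r can follow a letter.
Desubstitution : Letter → Word → Word → Set
Desubstitution a  (L1 ∷ [])         y = a ≡ L0
Desubstitution a  (L2 ∷ L2 ∷ [])    y = a ≡ L0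
Desubstitution L1 []                y = Occurs (L0 ∷ y)
Desubstitution L2 []                y = Σ Letter λ c → ¬ c ≡ L0 × Occurs (c ∷ y)
Desubstitution L0 (L2 ∷ [])         y = Occurs (L2 ∷ y)
Desubstitution L2 (L2 ∷ [])         y = Occurs (L1 ∷ y)
Desubstitution _  _                 _ = ⊥

block-ending-1 : ∀ t c → t ∷ʳ L1 ≡ f c → c ≡ L0
block-ending-1 t L0 e = refl
block-ending-1 t L1 e with () ← proj₂ (∷ʳ-injective t (L0 ∷ L2 ∷ []) e)
block-ending-1 t L2 e with () ← proj₂ (∷ʳ-injective t (L0 ∷ []) e)

block-ending-2 : ∀ t c → t ∷ʳ L2 ≡ f c → ¬ c ≡ L0
block-ending-2 t L0 e refl with () ← proj₂ (∷ʳ-injective t (L0 ∷ []) e)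

block-ending-22 : ∀ t c → t ++ L2 ∷ L2 ∷ [] ≡ f c → c ≡ L1
block-ending-22 t L1 e = refl
block-ending-22 t L0 e with () ← proj₂ (∷ʳ-injective (t ∷ʳ L2) (L0 ∷ []) (trans (∷ʳ-∷ʳ t L2 L2) e))
block-ending-22 t L2 e
  with () ← proj₂ (∷ʳ-injective t [] (proj₁ (∷ʳ-injective (t ∷ʳ L2) (L0 ∷ []) (trans (∷ʳ-∷ʳ t L2 L2) e))))

desubstitute : ∀ a r y → ZeroFree r → Occurs ((a ∷ r) ++ fWord y ++ L0 ∷ []) → Desubstitution a r y
desubstitute L0 []               y _ h with R , e ← fWord-++-0∷≡0∷ y [] =
  ⊥-elim (¬Admissible-00 R (subst (λ v → Admissible (L0 ∷ v)) e (Occurs⇒Admissible h)))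
desubstitute L1 []               y _ h with c , t , e , hc ← Occurs-fWord⁻¹-after L1 [] y tt h
  with refl ← block-ending-1 t c e = hc
desubstitute L2 []               y _ h with c , t , e , hc ← Occurs-fWord⁻¹-after L2 [] y tt h =
  c , block-ending-2 t c e , hc
desubstitute a  (L1 ∷ [])        y _ h = 0-before-1 a (Occurs-prefix (a ∷ L1 ∷ []) _ h)
desubstitute a  (L1 ∷ L1 ∷ r)    y _ h = ⊥-elim (Occurs⇒Admissible₂ (Occurs-tail a _ h))
desubstitute a  (L1 ∷ L2 ∷ r)    y _ h = ⊥-elim (Occurs⇒Admissible₂ (Occurs-tail a _ h))
desubstitute L0 (L2 ∷ [])        y _ h = Occurs-fWord⁻¹ (L2 ∷ y) h
desubstitute L1 (L2 ∷ [])        y _ h = ⊥-elim (Occurs⇒Admissible₂ h)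
desubstitute L2 (L2 ∷ [])        y _ h with c , t , e , hc ← Occurs-fWord⁻¹-after L2 (L2 ∷ []) y tt h
  with refl ← block-ending-22 t c e = hc
desubstitute a  (L2 ∷ L1 ∷ r)    y _ h = ⊥-elim (Occurs⇒Admissible₂ (Occurs-tail a _ h))
desubstitute a  (L2 ∷ L2 ∷ [])   y _ h = 0-before-22 a (Occurs-prefix (a ∷ L2 ∷ L2 ∷ []) _ h)
desubstitute a  (L2 ∷ L2 ∷ L1 ∷ r) y _ h = ⊥-elim (Occurs⇒Admissible₃ (Occurs-tail a _ h))
desubstitute a  (L2 ∷ L2 ∷ L2 ∷ r) y _ h = ⊥-elim (Occurs⇒Admissible₃ (Occurs-tail a _ h))

Occurs-01⇒010 : ∀ W → Occurs (W ++ L0 ∷ L1 ∷ []) → Occurs (W ++ f L0 ++ L0 ∷ [])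
Occurs-01⇒010 W h with e , h′ ← Occurs-extendʳ h
  with h″ ← subst Occurs (++-assoc W (L0 ∷ L1 ∷ []) (e ∷ [])) h′
  with refl ← 0-after-1 e [] (Occurs-suffix (W ∷ʳ L0) _ (subst Occurs (sym (++-assoc W _ _)) h″)) = h″

Occurs-022⇒0220 : ∀ W → Occurs (W ++ L0 ∷ L2 ∷ L2 ∷ []) → Occurs (W ++ f L1 ++ L0 ∷ [])
Occurs-022⇒0220 W h with e , h′ ← Occurs-extendʳ h
  with h″ ← subst Occurs (++-assoc W (L0 ∷ L2 ∷ L2 ∷ []) (e ∷ [])) h′
  with refl ← 0-after-22 e (Occurs-suffix (W ∷ʳ L0) _ (subst Occurs (sym (++-assoc W _ _)) h″)) = h″

Occurs-02⇒block : ∀ W → Occurs (W ++ L0 ∷ L2 ∷ []) →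
  Σ Letter λ d → ¬ d ≡ L0 × Occurs (W ++ f d ++ L0 ∷ [])
Occurs-02⇒block W h with e , h′ ← Occurs-extendʳ h
  with h″ ← subst Occurs (++-assoc W (L0 ∷ L2 ∷ []) (e ∷ [])) h′ | e
... | L0 = L2 , (λ ()) , h″
... | L1 = ⊥-elim (Occurs⇒Admissible₂ (Occurs-suffix (W ++ L0 ∷ []) _ (subst Occurs (sym (++-assoc W _ _)) h″)))
... | L2 = L1 , (λ ()) , Occurs-022⇒0220 W h″

++-fWord-∷ʳ : ∀ r z d → (r ++ fWord z) ++ f d ++ L0 ∷ [] ≡ r ++ fWord (z ∷ʳ d) ++ L0 ∷ []
++-fWord-∷ʳ r z d = begin
  (r ++ fWord z) ++ f d ++ L0 ∷ []             ≡⟨ ++-assoc r (fWord z) _ ⟩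
  r ++ fWord z ++ f d ++ L0 ∷ []               ≡⟨ cong (λ v → r ++ fWord z ++ v ++ _) (sym (++-identityʳ (f d))) ⟩
  r ++ fWord z ++ fWord (d ∷ []) ++ L0 ∷ []    ≡⟨ cong (r ++_) (sym (++-assoc (fWord z) (fWord (d ∷ [])) _)) ⟩
  r ++ (fWord z ++ fWord (d ∷ [])) ++ L0 ∷ []  ≡⟨ cong (λ v → r ++ v ++ _) (sym (fWord-++ z (d ∷ []))) ⟩
  r ++ fWord (z ∷ʳ d) ++ L0 ∷ []               ∎

desubstitute-block : ∀ a r z d → ZeroFree r → Occurs ((a ∷ r ++ fWord z) ++ f d ++ L0 ∷ []) →
  Desubstitution a r (z ∷ʳ d)
desubstitute-block a r z d zr h = desubstitute a r (z ∷ʳ d) zr (subst Occurs (cong (a ∷_) (++-fWord-∷ʳ r z d)) h)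

DesubstitutionU : Letter → Word → Word → Set
DesubstitutionU a r z = Desubstitution a r (z ∷ʳ L0) × Σ Letter λ d → ¬ d ≡ L0 × Desubstitution a r (z ∷ʳ d)

DesubstitutionV : Letter → Word → Word → Set
DesubstitutionV a r z = Desubstitution a r (z ∷ʳ L2) × Desubstitution a r (z ∷ʳ L1)

Special12-desubstitute : ∀ a r z → ZeroFree r → Special L1 L2 ((a ∷ r ++ fWord z) ∷ʳ L0) →
  DesubstitutionU a r z
Special12-desubstitute a r z zr (h₁ , h₂) =
  let d , d≢0 , h = Occurs-02⇒block W (subst Occurs (∷ʳ-∷ʳ W L0 L2) h₂)
  in desubstitute-block a r z L0 zr (Occurs-01⇒010 W (subst Occurs (∷ʳ-∷ʳ W L0 L1) h₁)) ,
     d , d≢0 , desubstitute-block a r z d zr h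
  where
  W : Word
  W = a ∷ r ++ fWord z

Special02-desubstitute : ∀ a r z → ZeroFree r → Special L0 L2 ((a ∷ r ++ fWord z) ∷ʳ L0 ∷ʳ L2) →
  DesubstitutionV a r z
Special02-desubstitute a r z zr (h₀ , h₂) =
  desubstitute-block a r z L2 zr (subst Occurs (∷ʳ-∷ʳ-∷ʳ W L0 L2 L0) h₀) ,
  desubstitute-block a r z L1 zr (Occurs-022⇒0220 W (subst Occurs (∷ʳ-∷ʳ-∷ʳ W L0 L2 L2) h₂))
  where
  W : Word
  W = a ∷ r ++ fWord z

LeftUnique : (Word → Set) → Word → Set
LeftUnique P w = ∀ a b → P (a ∷ w) → P (b ∷ w) → a ≡ b

2-shares-successor-with-0 : ∀ c b w w′ → ¬ c ≡ L0 → Occurs (c ∷ b ∷ w) → Occurs (L0 ∷ b ∷ w′) → c ≡ L2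
2-shares-successor-with-0 L0 b w w′ c≢0 _ _ = ⊥-elim (c≢0 refl)
2-shares-successor-with-0 L1 b w w′ _   h h₀ with refl ← 0-after-1 b w h = ⊥-elim (Occurs⇒Admissible₂ h₀)
2-shares-successor-with-0 L2 b w w′ _   _ _  = refl

¬DesubstitutionU-1-2 : ∀ z → DesubstitutionU L1 [] z → DesubstitutionU L2 [] z →
  ¬ LeftUnique (Special L0 L2) z
¬DesubstitutionU-1-2 []      (h₀ , _) _ _ = Occurs⇒Admissible₂ h₀
¬DesubstitutionU-1-2 (e ∷ z) (h₀ , d , d≢0 , h) ((c₁ , c₁≢0 , k₁) , d′ , d′≢0 , c₂ , c₂≢0 , k₂) left-unique
  with refl ← 2-shares-successor-with-0 c₁ e _ _ c₁≢0 k₁ h₀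
  with refl ← 2-shares-successor-with-0 c₂ e _ _ c₂≢0 k₂ h₀
  with () ← left-unique L0 L2 (Special02-of-nonzero L0 (e ∷ z) d h₀ h d≢0)
                              (Special02-of-nonzero L2 (e ∷ z) d′ k₁ k₂ d′≢0)

¬DesubstitutionV-1-2 : ∀ z → DesubstitutionV L1 [] z → DesubstitutionV L2 [] z →
  ¬ LeftUnique (Special L1 L2) z
¬DesubstitutionV-1-2 []      _          (_ , c₂ , c₂≢0 , k₂) _ = c₂≢0 (0-before-1 c₂ k₂)
¬DesubstitutionV-1-2 (e ∷ z) (h₂ , h₁) ((c₁ , c₁≢0 , k₁) , c₂ , c₂≢0 , k₂) left-unique
  with refl ← 2-shares-successor-with-0 c₁ e _ _ c₁≢0 k₁ h₂
  with refl ← 2-shares-successor-with-0 c₂ e _ _ c₂≢0 k₂ h₂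
  with () ← left-unique L0 L2 (h₁ , h₂) (k₂ , k₁)

DesubstitutionU-unique : ∀ a b r z → DesubstitutionU a r z → DesubstitutionU b r z →
  LeftUnique (Special L0 L2) z → a ≡ b
DesubstitutionU-unique a  b  (L1 ∷ [])      z (a≡0 , _) (b≡0 , _) _ = trans a≡0 (sym b≡0)
DesubstitutionU-unique a  b  (L2 ∷ L2 ∷ []) z (a≡0 , _) (b≡0 , _) _ = trans a≡0 (sym b≡0)
DesubstitutionU-unique L1 L1 []             z _ _ _ = refl
DesubstitutionU-unique L2 L2 []             z _ _ _ = refl
DesubstitutionU-unique L1 L2 []             z A B ih = ⊥-elim (¬DesubstitutionU-1-2 z A B ih)
DesubstitutionU-unique L2 L1 []             z A B ih = ⊥-elim (¬DesubstitutionU-1-2 z B A ih)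
DesubstitutionU-unique L0 _  []             z (() , _) _ _
DesubstitutionU-unique _  L0 []             z _ (() , _) _
DesubstitutionU-unique L0 L0 (L2 ∷ [])      z _ _ _ = refl
DesubstitutionU-unique L2 L2 (L2 ∷ [])      z _ _ _ = refl
DesubstitutionU-unique L0 L2 (L2 ∷ [])      z (A₀ , d , d≢0 , A) (B₀ , d′ , d′≢0 , B) ih
  with () ← ih L2 L1 (Special02-of-nonzero L2 z d A₀ A d≢0) (Special02-of-nonzero L1 z d′ B₀ B d′≢0)
DesubstitutionU-unique L2 L0 (L2 ∷ [])      z (A₀ , d , d≢0 , A) (B₀ , d′ , d′≢0 , B) ih
  with () ← ih L1 L2 (Special02-of-nonzero L1 z d A₀ A d≢0) (Special02-of-nonzero L2 z d′ B₀ B d′≢0)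
DesubstitutionU-unique L1 _  (L2 ∷ [])      z (() , _) _ _
DesubstitutionU-unique _  L1 (L2 ∷ [])      z _ (() , _) _
DesubstitutionU-unique _  _  (L0 ∷ _)           z (() , _) _ _
DesubstitutionU-unique _  _  (L1 ∷ _ ∷ _)       z (() , _) _ _
DesubstitutionU-unique _  _  (L2 ∷ L0 ∷ _)      z (() , _) _ _
DesubstitutionU-unique _  _  (L2 ∷ L1 ∷ _)      z (() , _) _ _
DesubstitutionU-unique _  _  (L2 ∷ L2 ∷ _ ∷ _)  z (() , _) _ _

DesubstitutionV-unique : ∀ a b r z → DesubstitutionV a r z → DesubstitutionV b r z →
  LeftUnique (Special L1 L2) z → a ≡ b
DesubstitutionV-unique a  b  (L1 ∷ [])      z (a≡0 , _) (b≡0 , _) _ = trans a≡0 (sym b≡0)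
DesubstitutionV-unique a  b  (L2 ∷ L2 ∷ []) z (a≡0 , _) (b≡0 , _) _ = trans a≡0 (sym b≡0)
DesubstitutionV-unique L1 L1 []             z _ _ _ = refl
DesubstitutionV-unique L2 L2 []             z _ _ _ = refl
DesubstitutionV-unique L1 L2 []             z A B ih = ⊥-elim (¬DesubstitutionV-1-2 z A B ih)
DesubstitutionV-unique L2 L1 []             z A B ih = ⊥-elim (¬DesubstitutionV-1-2 z B A ih)
DesubstitutionV-unique L0 _  []             z (() , _) _ _
DesubstitutionV-unique _  L0 []             z _ (() , _) _
DesubstitutionV-unique L0 L0 (L2 ∷ [])      z _ _ _ = refl
DesubstitutionV-unique L2 L2 (L2 ∷ [])      z _ _ _ = refl
DesubstitutionV-unique L0 L2 (L2 ∷ [])      z (A₂ , A₁) (B₂ , B₁) ih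
  with () ← ih L2 L1 (A₁ , A₂) (B₁ , B₂)
DesubstitutionV-unique L2 L0 (L2 ∷ [])      z (A₂ , A₁) (B₂ , B₁) ih
  with () ← ih L1 L2 (A₁ , A₂) (B₁ , B₂)
DesubstitutionV-unique L1 _  (L2 ∷ [])      z (() , _) _ _
DesubstitutionV-unique _  L1 (L2 ∷ [])      z _ (() , _) _
DesubstitutionV-unique _  _  (L0 ∷ _)           z (() , _) _ _
DesubstitutionV-unique _  _  (L1 ∷ _ ∷ _)       z (() , _) _ _
DesubstitutionV-unique _  _  (L2 ∷ L0 ∷ _)      z (() , _) _ _
DesubstitutionV-unique _  _  (L2 ∷ L1 ∷ _)      z (() , _) _ _
DesubstitutionV-unique _  _  (L2 ∷ L2 ∷ _ ∷ _)  z (() , _) _ _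

length-fWord : ∀ z → length z ≤ length (fWord z)
length-fWord []       = z≤n
length-fWord (L0 ∷ z) = s≤s (m≤n⇒m≤1+n (length-fWord z))
length-fWord (L1 ∷ z) = s≤s (m≤n⇒m≤1+n (m≤n⇒m≤1+n (length-fWord z)))
length-fWord (L2 ∷ z) = s≤s (m≤n⇒m≤1+n (length-fWord z))

length-preimage : ∀ r z v → length z < length ((r ++ fWord z) ++ L0 ∷ v)
length-preimage r z v rewrite length-++ (r ++ fWord z) {L0 ∷ v} | +-suc (length (r ++ fWord z)) (length v) =
  s≤s (≤-trans (≤-trans (length-fWord z) (length-++-≤ʳ (fWord z) {r})) (m≤m+n _ (length v)))

mutual
  Special12-left-unique-below : ∀ n w → length w < n → LeftUnique (Special L1 L2) w
  Special12-left-unique-below (suc n) w (s≤s |w|≤n) a b ua ub with initLast w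
  ... | [] = trans (0-before-1 a (proj₁ ua)) (sym (0-before-1 b (proj₁ ub)))
  ... | w′ ∷ʳ′ c with refl ← 0-before-1 c (Occurs-last-two (a ∷ w′) c L1 (proj₁ ua))
    with r , z , refl , zr ← admissible-parse w′
           (Occurs⇒Admissible (Occurs-init (Occurs-tail a _ (proj₁ ua)))) =
    DesubstitutionU-unique a b r z (Special12-desubstitute a r z zr ua) (Special12-desubstitute b r z zr ub)
      (Special02-left-unique-below n z (≤-trans (length-preimage r z []) |w|≤n))

  Special02-left-unique-below : ∀ n w → length w < n → LeftUnique (Special L0 L2) w
  Special02-left-unique-below (suc n) w (s≤s |w|≤n) a b (a0 , a2) (b0 , b2) with initLast w
  ... | [] = trans (2-before-0-and-2 a a0 a2) (sym (2-before-0-and-2 b b0 b2))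
  ... | w′ ∷ʳ′ c
    with refl ← 2-before-0-and-2 c (Occurs-last-two (a ∷ w′) c L0 a0) (Occurs-last-two (a ∷ w′) c L2 a2)
    with initLast w′
  ... | [] = trans (0-before-22 a a2) (sym (0-before-22 b b2))
  ... | w″ ∷ʳ′ c′
    with refl ← 0-before-22 c′ (Occurs-suffix (a ∷ w″) _ (subst Occurs (∷ʳ-∷ʳ-∷ʳ (a ∷ w″) c′ L2 L2) a2))
    with r , z , refl , zr ← admissible-parse w″
           (Occurs⇒Admissible (Occurs-init (Occurs-init (Occurs-tail a _ a0)))) =
    DesubstitutionV-unique a b r z
      (Special02-desubstitute a r z zr (a0 , a2)) (Special02-desubstitute b r z zr (b0 , b2))
      (Special12-left-unique-below n z (≤-trans (length-preimage r z (L2 ∷ []))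
        (subst (λ v → length v ≤ n) (∷ʳ-∷ʳ (r ++ fWord z) L0 L2) |w|≤n)))

Special12-left-unique : ∀ w → LeftUnique (Special L1 L2) w
Special12-left-unique w = Special12-left-unique-below (suc (length w)) w ≤-refl

Special02-left-unique : ∀ w → LeftUnique (Special L0 L2) w
Special02-left-unique w = Special02-left-unique-below (suc (length w)) w ≤-refl

Special-unique : ∀ {a b} → (∀ w → LeftUnique (Special a b) w) →
  ∀ w w′ → length w ≡ length w′ → Special a b w → Special a b w′ → w ≡ w′
Special-unique left-unique []      []        _ _ _ = refl
Special-unique left-unique (c ∷ t) (c′ ∷ t′) l s s′
  with refl ← Special-unique left-unique t t′ (suc-injective l)
                (Special-suffix (c ∷ []) t s) (Special-suffix (c′ ∷ []) t′ s′) =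
  cong (_∷ t) (left-unique t c c′ s s′)

-- With u = uWord k and v = vWord k, f carries each family to the other:
-- f(v2)·01 = f(v20), f(v2)·02 ⊑ f(v22), f(u0)·022 = f(u01) and f(u0)·020 ⊑ f(u02e).
mutual
  uWord : ℕ → Word
  uWord zero    = []
  uWord (suc k) = fWord (vWord k ∷ʳ L2)

  vWord : ℕ → Word
  vWord zero    = []
  vWord (suc k) = fWord (uWord k ∷ʳ L0) ∷ʳ L0

mutual
  uWord-special : ∀ k → Special L1 L2 (uWord k ∷ʳ L0)
  uWord-special zero    = (1 , [] , [] , refl) , (2 , L0 ∷ L1 ∷ [] , L2 ∷ [] , refl)
  uWord-special (suc k) = let W = vWord k ∷ʳ L2 in
    subst Occurs (sym (∷ʳ-∷ʳ (fWord W) L0 L1)) (Occurs-f-block W L0 (proj₁ (vWord-special k))) ,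
    subst Occurs (sym (∷ʳ-∷ʳ (fWord W) L0 L2)) (Occurs-f-block W L2 (proj₂ (vWord-special k)))

  vWord-special : ∀ k → Special L0 L2 (vWord k ∷ʳ L2)
  vWord-special zero    = (3 , L0 ∷ L1 ∷ L0 ∷ L2 ∷ [] , L1 ∷ L0 ∷ L2 ∷ L0 ∷ L2 ∷ [] , refl) ,
                          (3 , L0 ∷ L1 ∷ L0 ∷ [] , L0 ∷ L1 ∷ L0 ∷ L2 ∷ L0 ∷ L2 ∷ [] , refl)
  vWord-special (suc k) with e , h ← Occurs-extendʳ (proj₂ (uWord-special k)) =
    subst Occurs (sym (∷ʳ-∷ʳ-∷ʳ (fWord W) L0 L2 L0))
      (Occurs-prefix (fWord W ++ L0 ∷ L2 ∷ L0 ∷ []) (fTail e) (subst Occurs (f-image e) (Occurs-fWord h))) ,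
    subst Occurs (sym (∷ʳ-∷ʳ-∷ʳ (fWord W) L0 L2 L2)) (Occurs-f-block W L1 (proj₁ (uWord-special k)))
    where
    W : Word
    W = uWord k ∷ʳ L0
    f-image : ∀ c → fWord (W ∷ʳ L2 ∷ʳ c) ≡ (fWord W ++ L0 ∷ L2 ∷ L0 ∷ []) ++ fTail c
    f-image c = begin
      fWord (W ∷ʳ L2 ∷ʳ c)                       ≡⟨ fWord-++ (W ∷ʳ L2) (c ∷ []) ⟩
      fWord (W ∷ʳ L2) ++ f c ++ []               ≡⟨ cong₂ _++_ (fWord-++ W (L2 ∷ []))
                                                               (trans (++-identityʳ (f c)) (f≡0∷fTail c)) ⟩
      (fWord W ++ L0 ∷ L2 ∷ []) ++ L0 ∷ fTail c  ≡⟨ ++-assoc (fWord W) _ _ ⟩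
      fWord W ++ L0 ∷ L2 ∷ L0 ∷ fTail c          ≡⟨ sym (++-assoc (fWord W) _ (fTail c)) ⟩
      (fWord W ++ L0 ∷ L2 ∷ L0 ∷ []) ++ fTail c  ∎

length-f-block : ∀ W e → length W < length (fWord (W ∷ʳ e))
length-f-block W e = ≤-trans (≤-reflexive (sym (length-∷ʳ W e))) (length-fWord (W ∷ʳ e))

mutual
  length-uWord : ∀ k → k ≤ length (uWord k)
  length-uWord zero    = z≤n
  length-uWord (suc k) = ≤-trans (s≤s (length-vWord k)) (length-f-block (vWord k) L2)

  length-vWord : ∀ k → k ≤ length (vWord k)
  length-vWord zero    = z≤n
  length-vWord (suc k) = ≤-trans (s≤s (≤-trans (length-uWord k) (<⇒≤ (length-f-block (uWord k) L0))))
                             (≤-reflexive (sym (length-∷ʳ (fWord (uWord k ∷ʳ L0)) L0)))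

Special-suffix-of-length : ∀ {a b c} m W → m ≤ length W → Special a b (W ∷ʳ c) →
  Σ Word λ s → (length s ≡ m) × Special a b (s ∷ʳ c)
Special-suffix-of-length {c = c} m W m≤|W| h =
  drop k W , trans (length-drop k W) (m∸[m∸n]≡n m≤|W|) ,
  Special-suffix (take k W) (drop k W ∷ʳ c) (subst (Special _ _) split h)
  where
  k : ℕ
  k = length W ∸ m
  split : W ∷ʳ c ≡ take k W ++ drop k W ∷ʳ c
  split = trans (cong (_∷ʳ c) (sym (take++drop≡id k W))) (++-assoc (take k W) (drop k W) (c ∷ []))

RightSpecial⇒Special : ∀ w → ¬ w ≡ [] → RightSpecial x w → Special L1 L2 w ⊎ Special L0 L2 w
RightSpecial⇒Special w w≢[] (a , b , a≢b , ha , hb) = classify a b a≢b (Factor⇒Occurs ha) (Factor⇒Occurs hb)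
  where
  classify : ∀ a b → ¬ a ≡ b → Occurs (w ∷ʳ a) → Occurs (w ∷ʳ b) → Special L1 L2 w ⊎ Special L0 L2 w
  classify L0 L0 a≢b _  _  = ⊥-elim (a≢b refl)
  classify L1 L1 a≢b _  _  = ⊥-elim (a≢b refl)
  classify L2 L2 a≢b _  _  = ⊥-elim (a≢b refl)
  classify L0 L1 _   h₀ h₁ = ⊥-elim (w≢[] (Special01⇒[] w (h₀ , h₁)))
  classify L1 L0 _   h₁ h₀ = ⊥-elim (w≢[] (Special01⇒[] w (h₀ , h₁)))
  classify L1 L2 _   h₁ h₂ = inj₁ (h₁ , h₂)
  classify L2 L1 _   h₂ h₁ = inj₁ (h₁ , h₂)
  classify L0 L2 _   h₀ h₂ = inj₂ (h₀ , h₂)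
  classify L2 L0 _   h₂ h₀ = inj₂ (h₀ , h₂)

proposition22 : (n : ℕ) → n ≥ 1 →
    Σ (List Letter) λ u → Σ (List Letter) λ v →
      (length u ≡ n) × (∃ λ u′ → u ≡ u′ ∷ʳ zero)
        × Factor x (u ∷ʳ suc zero) × Factor x (u ∷ʳ suc (suc zero))
      × (length v ≡ n) × (∃ λ v′ → v ≡ v′ ∷ʳ suc (suc zero))
        × Factor x (v ∷ʳ zero) × Factor x (v ∷ʳ suc (suc zero))
      × ((w : List Letter) → length w ≡ n → RightSpecial x w → (w ≡ u) ⊎ (w ≡ v))
proposition22 (suc m) _
  with su , |su| , hu ← Special-suffix-of-length m (uWord m) (length-uWord m) (uWord-special m)
     | sv , |sv| , hv ← Special-suffix-of-length m (vWord m) (length-vWord m) (vWord-special m) =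
  su ∷ʳ L0 , sv ∷ʳ L2 ,
  |u| , (su , refl) , Occurs⇒Factor (proj₁ hu) , Occurs⇒Factor (proj₂ hu) ,
  |v| , (sv , refl) , Occurs⇒Factor (proj₁ hv) , Occurs⇒Factor (proj₂ hv) ,
  only-u-and-v
  where
  |u| : length (su ∷ʳ L0) ≡ suc m
  |u| = trans (length-∷ʳ su L0) (cong suc |su|)
  |v| : length (sv ∷ʳ L2) ≡ suc m
  |v| = trans (length-∷ʳ sv L2) (cong suc |sv|)
  only-u-and-v : (w : Word) → length w ≡ suc m → RightSpecial x w → (w ≡ su ∷ʳ L0) ⊎ (w ≡ sv ∷ʳ L2)
  only-u-and-v w |w| rs with RightSpecial⇒Special w (λ { refl → 0≢1+n |w| }) rs
  ... | inj₁ s = inj₁ (Special-unique Special12-left-unique w _ (trans |w| (sym |u|)) s hu)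
  ... | inj₂ s = inj₂ (Special-unique Special02-left-unique w _ (trans |w| (sym |v|)) s hv)
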